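{- Let $\varepsilon\colon X^{\times}_{\mathrm{irr}}\to\mathcal{P}(M)$ be a Fitch map explained by the edge-labeled tree $(T,\lambda)$, and let $\widehat{T}(\varepsilon)$ be the $\varepsilon$-tree. Then $(T,\lambda)$ is isomorphic to $\widehat{T}(\varepsilon)$ if and only if for every inner edge $e=(\mathrm{par}_T(v),v)$ of $T$: (1) $\lambda(e)\neq\emptyset$, and (2) for every $m\in\lambda(\mathrm{par}(v),v)$ there is a leaf $y\in X$ such that there is no $m$-edge along the path from $v$ to $y$ in $(T,\lambda)$.
   Context: $X$ is a finite nonempty set, $M$ a finite nonempty set of colors, $X^{\times}_{\mathrm{irr}}=\{(x,y)\in X\times X: x\neq y\}$. A phylogenetic tree on $X$ is a rooted tree whose leaves (non-root vertices of degree $1$) form $X$, whose root has degree $\ge2$ and whose non-root inner vertices have degree $\ge3$; it is determined up to isomorphism by its cluster set $\mathcal{C}(T)=\{C_T(v):v\in V(T)\}$ ($C_T(v)$ = leaves descending from $v$). Inner vertices are non-leaves; an inner edge is an edge both of whose endpoints are inner vertices. $\mathrm{lca}(x,y)$ is the last common ancestor; edges are written $(\mathrm{par}(v),v)$. An edge-labeled tree $(T,\lambda)$ on $X$ with $M$ is a phylogenetic tree $T$ on $X$ with $\lambda\colon E(T)\to\mathcal{P}(M)$; $e$ is an $m$-edge if $m\in\lambda(e)$. $(T,\lambda)$ explains $\varepsilon$ if for all $(x,y)\in X^{\times}_{\mathrm{irr}}$, $m\in M$: $m\in\varepsilon(x,y)$ iff the path from $\mathrm{lca}(x,y)$ to $y$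 contains an $m$-edge; $\varepsilon$ is a Fitch map if some edge-labeled tree explains it. $N_m[y]=\{x\in X\setminus\{y\}: m\notin\varepsilon(x,y)\}\cup\{y\}$, $\mathcal{N}[\varepsilon]=\{N_m[y]: y\in X, m\in M\}$. The $\varepsilon$-tree $(\widehat{T},\widehat{\lambda})$: $\mathcal{C}(\widehat{T})=\mathcal{N}[\varepsilon]\cup\{X\}\cup\{\{x\}:x\in X\}$ and $\widehat{\lambda}(\mathrm{par}(v),v)=\{m\in M:\exists y\in X,\ C_{\widehat{T}}(v)=N_m[y]\}$. $(T',\lambda')$ is a coarse-graining of $(T,\lambda)$ if $\mathcal{C}(T')\subseteq\mathcal{C}(T)$ and for all non-root $v'\in V(T')$, non-root $v\in V(T)$ with $C_T(v)=C_{T'}(v')$: $\lambda'(\mathrm{par}_{T'}(v'),v')\subseteq\lambda(\mathrm{par}_T(v),v)$. Two edge-labeled trees are isomorphic if each is a coarse-graining of the other. -}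

module Defs where

open import Data.Nat using (ℕ; _≤_)
open import Data.Bool using (Bool; true; false; not; if_then_else_)
open import Data.Fin using (Fin)
open import Data.Fin.Properties using (any?)
open import Data.Fin.Subset using (Subset; _∈_; _∉_; _⊆_; _⊂_; ⊤; ⁅_⁆; Nonempty)
open import Data.Fin.Subset.Properties using (_∈?_)
open import Data.Vec using (tabulate)
open import Data.Vec.Properties using (≡-dec)
open import Data.List using (List; _∷_; map; concatMap; _++_; allFin)
open import Data.List.Membership.Propositional using () renaming (_∈_ to _∈ₗ_)
open import Data.Product using (Σ; ∃; _×_; _,_)
open import Data.Sum using (_⊎_)
open import Relation.Nullary using (¬_; ⌊_⌋)
open import Relation.Binary.PropositionalEquality using (_≡_; _≢_)
import Data.Bool.Properties as BoolP
import Data.Fin.Properties as FinP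

-- Leaves X = Fin n, colours M = Fin k.
-- An edge-labeled tree is represented through its cluster set (a phylogenetic
-- tree is determined up to isomorphism by its cluster set; vertex v <-> C_T(v),
-- the edge (par(v),v) <-> the non-root cluster C_T(v)), together with the
-- labeling  label C = λ(par(v),v)  for the vertex v with C_T(v) = C.
-- Values of `label` on non-clusters and on the root cluster X are irrelevant.
record ELTree (n k : ℕ) : Set where
  constructor mkTree
  field
    clusters : List (Subset n)
    label    : Subset n → Subset k
open ELTree public

_∈𝒞_ : ∀ {n k} → Subset n → ELTree n k → Set
C ∈𝒞 T = C ∈ₗ clusters T

-- Cluster sets of phylogenetic trees on X (root degree ≥ 2 forces |X| ≥ 2;
-- inner vertices of degree ≥ 3 / root degree ≥ 2 <-> distinct vertices have
-- distinct clusters, which is built into the cluster representation):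
-- a hierarchy containing X and all singletons, all clusters nonempty.
record IsPhylogenetic {n k : ℕ} (T : ELTree n k) : Set where
  field
    atLeastTwo  : 2 ≤ n
    hasRoot     : ⊤ ∈𝒞 T
    hasLeaves   : ∀ (x : Fin n) → ⁅ x ⁆ ∈𝒞 T
    nonempty    : ∀ C → C ∈𝒞 T → Nonempty C
    compatible  : ∀ A B → A ∈𝒞 T → B ∈𝒞 T →
                  A ⊆ B ⊎ B ⊆ A ⊎ (∀ x → x ∈ A → x ∉ B)

-- A map ε : X^×_irr → P(M); the values on the diagonal are ignored.
Map : ℕ → ℕ → Set
Map n k = Fin n → Fin n → Subset k

-- (T,λ) explains ε: for x ≠ y, m ∈ ε(x,y) iff the path from lca(x,y) to y
-- contains an m-edge, i.e. iff some cluster C of T with y ∈ C, x ∉ C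
-- (exactly the lower endpoints of the edges on that path) has m ∈ λ(C).
Explains : ∀ {n k} → ELTree n k → Map n k → Set
Explains T ε = ∀ x y → x ≢ y → ∀ m →
  (m ∈ ε x y → Σ _ λ C → C ∈𝒞 T × y ∈ C × x ∉ C × m ∈ label T C) ×
  ((Σ _ λ C → C ∈𝒞 T × y ∈ C × x ∉ C × m ∈ label T C) → m ∈ ε x y)

N : ∀ {n k} → Map n k → Fin k → Fin n → Subset n
N ε m y = tabulate λ x →
  if ⌊ x FinP.≟ y ⌋ then true else not ⌊ m ∈? ε x y ⌋

εTree : ∀ {n k} → Map n k → ELTree n k
εTree {n} {k} ε = mkTree
  (⊤ ∷ map ⁅_⁆ (allFin n) ++ concatMap (λ y → map (λ m → N ε m y) (allFin k)) (allFin n))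
  (λ C → tabulate λ m → ⌊ any? (λ y → ≡-dec BoolP._≟_ C (N ε m y)) ⌋)

CoarseGraining : ∀ {n k} → ELTree n k → ELTree n k → Set
CoarseGraining T' T =
  (∀ C → C ∈𝒞 T' → C ∈𝒞 T) ×
  (∀ C → C ∈𝒞 T' → C ≢ ⊤ → label T' C ⊆ label T C)

Isomorphic : ∀ {n k} → ELTree n k → ELTree n k → Set
Isomorphic T T' = CoarseGraining T T' × CoarseGraining T' T

-- inner edge (par(v),v): v is neither the root (C ≠ X) nor a leaf (|C| ≥ 2,
-- equivalently C not a singleton); par(v) is then automatically inner.
InnerEdge : ∀ {n k} → ELTree n k → Subset n → Set
InnerEdge T C = C ∈𝒞 T × C ≢ ⊤ × (∀ x → C ≢ ⁅ x ⁆)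

-- The path from v to a leaf y ∈ C_T(v) consists of the
-- edges above the vertices w with y ∈ C_T(w) ⊊ C_T(v).
EdgeCondition : ∀ {n k} → ELTree n k → Subset n → Set
EdgeCondition T C =
  Nonempty (label T C) ×
  (∀ m → m ∈ label T C →
     Σ (Fin _) λ y → y ∈ C ×
       (∀ D → D ∈𝒞 T → D ⊂ C → y ∈ D → m ∉ label T D))

{-# OPTIONS --safe #-}
-- Since T explains ε, x ∈ N_m[y] iff no m-edge of T separates y from x, so N_m[y]
-- is X or the cluster below the lowest m-edge above y.  Hence the ε-tree is always
-- a coarse-graining of T, and T is one of the ε-tree iff every m-edge (par(v), v)
-- is the lowest m-edge above some leaf y below v.  For leaf edges this is
-- automatic; for inner edges it is condition (2), and condition (1) holds because
-- the ε-tree's clusters other than X and the singletons are all of the form N_m[y].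
module Submission where

open import Defs
open import Data.Nat using (ℕ)
open import Data.Bool using (Bool; T; true; not; if_then_else_)
open import Data.Empty using (⊥-elim)
open import Data.Fin using (Fin)
import Data.Fin.Properties as Fin
open import Data.Fin.Subset using (Subset; _∈_; _∉_; _⊆_; _⊂_; ⊤; ⁅_⁆; Nonempty)
open import Data.Fin.Subset.Properties
  using (_∈?_; ⊆⊤; x∈⁅x⁆; x∈⁅y⁆⇒x≡y; ⊆-antisym; ⊆-preorder)
open import Data.List using ([]; _∷_; map; allFin)
open import Data.List.Membership.Propositional using () renaming (_∈_ to _∈ₗ_)
open import Data.List.Membership.Propositional.Properties
  using (∈-map⁺; ∈-map⁻; ∈-++⁺ˡ; ∈-++⁺ʳ; ∈-++⁻; ∈-concat⁺′; ∈-concat⁻′; ∈-allFin)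
open import Data.List.Relation.Unary.Any using (here; there)
open import Data.Product using (∃; _×_; _,_; proj₁; proj₂)
open import Data.Sum using (_⊎_; inj₁; inj₂)
open import Data.Vec using (tabulate)
open import Data.Vec.Properties using (≡-dec; lookup⇒[]=; []=⇒lookup; lookup∘tabulate)
import Data.Bool.Properties as Bool
open import Function.Bundles using (Equivalence)
open import Level using (Level)
open import Relation.Binary.Bundles using (Preorder)
open import Relation.Nullary using (¬_; yes; no; ⌊_⌋)
open import Relation.Nullary.Decidable using (_×-dec_; toWitness; fromWitness)
open import Relation.Unary using (Pred; Decidable)
open import Relation.Binary.PropositionalEquality using (_≡_; _≢_; refl; sym; trans; subst)

∈-tabulate⁺ : ∀ {n} {f : Fin n → Bool} {x} → T (f x) → x ∈ tabulate f
∈-tabulate⁺ {f = f} {x} t = lookup⇒[]= x _ (trans (lookup∘tabulate f x) (Equivalence.to Bool.T-≡ t))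

∈-tabulate⁻ : ∀ {n} {f : Fin n → Bool} {x} → x ∈ tabulate f → T (f x)
∈-tabulate⁻ {f = f} {x} x∈ = Equivalence.from Bool.T-≡ (trans (sym (lookup∘tabulate f x)) ([]=⇒lookup x∈))

module _ {a ℓ₁ ℓ₂ p : Level} (P : Preorder a ℓ₁ ℓ₂) where
  open Preorder P using () renaming (Carrier to A; _≲_ to _≤_; refl to ≤-refl; trans to ≤-trans)

  least-satisfying : {Q : Pred A p} → Decidable Q → ∀ xs →
    (∀ {u v} → u ∈ₗ xs → v ∈ₗ xs → Q u → Q v → u ≤ v ⊎ v ≤ u) →
    (∀ {u} → u ∈ₗ xs → ¬ Q u) ⊎
    ∃ λ l → l ∈ₗ xs × Q l × ∀ {u} → u ∈ₗ xs → Q u → l ≤ u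
  least-satisfying Q? [] _ = inj₁ λ ()
  least-satisfying Q? (x ∷ xs) total
    with least-satisfying Q? xs (λ u∈ v∈ → total (there u∈) (there v∈)) | Q? x
  ... | inj₁ none | no ¬Qx = inj₁ λ { (here refl) → ¬Qx ; (there u∈) → none u∈ }
  ... | inj₁ none | yes Qx =
    inj₂ (x , here refl , Qx , λ { (here refl) _ → ≤-refl ; (there u∈) Qu → ⊥-elim (none u∈ Qu) })
  ... | inj₂ (l , l∈ , Ql , l≤) | no ¬Qx =
    inj₂ (l , there l∈ , Ql , λ { (here refl) Qx → ⊥-elim (¬Qx Qx) ; (there u∈) → l≤ u∈ })
  ... | inj₂ (l , l∈ , Ql , l≤) | yes Qx with total (here refl) (there l∈) Qx Ql
  ...   | inj₁ x≤l =
    inj₂ (x , here refl , Qx , λ { (here refl) _ → ≤-refl ; (there u∈) Qu → ≤-trans x≤l (l≤ u∈ Qu) })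
  ...   | inj₂ l≤x =
    inj₂ (l , there l∈ , Ql , λ { (here refl) _ → l≤x ; (there u∈) → l≤ u∈ })

module _ {n k : ℕ} (ε : Map n k) where

  ∈-N⁺ : ∀ {m x y} → x ≡ y ⊎ m ∉ ε x y → x ∈ N ε m y
  ∈-N⁺ {m} {x} {y} x≡y⊎m∉ = ∈-tabulate⁺ (member x≡y⊎m∉)
    where
    member : x ≡ y ⊎ m ∉ ε x y → T (if ⌊ x Fin.≟ y ⌋ then true else not ⌊ m ∈? ε x y ⌋)
    member h with x Fin.≟ y | m ∈? ε x y | h
    ... | yes _  | _      | _        = _
    ... | no _   | no _   | _        = _
    ... | no x≢y | yes _  | inj₁ x≡y = x≢y x≡y
    ... | no _   | yes m∈ | inj₂ m∉  = m∉ m∈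

  ∈-N⁻ : ∀ {m x y} → x ∈ N ε m y → x ≡ y ⊎ m ∉ ε x y
  ∈-N⁻ {m} {x} {y} x∈N = member (∈-tabulate⁻ x∈N)
    where
    member : T (if ⌊ x Fin.≟ y ⌋ then true else not ⌊ m ∈? ε x y ⌋) → x ≡ y ⊎ m ∉ ε x y
    member with x Fin.≟ y | m ∈? ε x y
    ... | yes x≡y | _     = λ _ → inj₁ x≡y
    ... | no _    | no m∉ = λ _ → inj₂ m∉
    ... | no _    | yes _ = λ ()

  ∈-label-εTree⁺ : ∀ {m C} y → C ≡ N ε m y → m ∈ label (εTree ε) C
  ∈-label-εTree⁺ y C≡N = ∈-tabulate⁺ (fromWitness (y , C≡N))

  ∈-label-εTree⁻ : ∀ {m C} → m ∈ label (εTree ε) C → ∃ λ y → C ≡ N ε m y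
  ∈-label-εTree⁻ m∈ = toWitness (∈-tabulate⁻ m∈)

  ⊤∈εTree : ⊤ ∈𝒞 εTree ε
  ⊤∈εTree = here refl

  ⁅x⁆∈εTree : ∀ x → ⁅ x ⁆ ∈𝒞 εTree ε
  ⁅x⁆∈εTree x = there (∈-++⁺ˡ (∈-map⁺ ⁅_⁆ (∈-allFin x)))

  N∈εTree : ∀ m y → N ε m y ∈𝒞 εTree ε
  N∈εTree m y = there (∈-++⁺ʳ (map ⁅_⁆ (allFin n))
    (∈-concat⁺′ (∈-map⁺ (λ m → N ε m y) (∈-allFin m))
                (∈-map⁺ (λ y → map (λ m → N ε m y) (allFin k)) (∈-allFin y))))

  ∈𝒞-εTree⁻ : ∀ {C} → C ∈𝒞 εTree ε →
    C ≡ ⊤ ⊎ (∃ λ x → C ≡ ⁅ x ⁆) ⊎ (∃ λ m → ∃ λ y → C ≡ N ε m y)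
  ∈𝒞-εTree⁻ (here C≡⊤) = inj₁ C≡⊤
  ∈𝒞-εTree⁻ (there C∈) with ∈-++⁻ (map ⁅_⁆ (allFin n)) C∈
  ... | inj₁ C∈leaves = let x , _ , C≡⁅x⁆ = ∈-map⁻ ⁅_⁆ C∈leaves in inj₂ (inj₁ (x , C≡⁅x⁆))
  ... | inj₂ C∈Ns
    with Ns , C∈Ns , Ns∈ ← ∈-concat⁻′ (map (λ y → map (λ m → N ε m y) (allFin k)) (allFin n)) C∈Ns
    with y , _ , refl ← ∈-map⁻ (λ y → map (λ m → N ε m y) (allFin k)) Ns∈
    with m , _ , C≡N ← ∈-map⁻ (λ m → N ε m y) C∈Ns
    = inj₂ (inj₂ (m , y , C≡N))

module Explained {n k : ℕ} {ε : Map n k} {T : ELTree n k}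
                 (phylogenetic : IsPhylogenetic T) (explains : Explains T ε) where
  open IsPhylogenetic phylogenetic

  Unseparated : Fin k → Fin n → Fin n → Set
  Unseparated m y x = ∀ D → D ∈𝒞 T → y ∈ D → x ∉ D → m ∉ label T D

  PathFree : Fin k → Subset n → Fin n → Set
  PathFree m C y = ∀ D → D ∈𝒞 T → D ⊂ C → y ∈ D → m ∉ label T D

  ∈-N⇒unseparated : ∀ {m x y} → x ∈ N ε m y → Unseparated m y x
  ∈-N⇒unseparated {m} {x} {y} x∈N D D∈T y∈D x∉D m∈D with ∈-N⁻ ε x∈N
  ... | inj₁ refl = x∉D y∈D
  ... | inj₂ m∉ε = m∉ε (proj₂ (explains x y x≢y m) (D , D∈T , y∈D , x∉D , m∈D))
    where
    x≢y : x ≢ y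
    x≢y refl = x∉D y∈D

  unseparated⇒∈-N : ∀ {m x y} → Unseparated m y x → x ∈ N ε m y
  unseparated⇒∈-N {m} {x} {y} unsep with x Fin.≟ y
  ... | yes x≡y = ∈-N⁺ ε (inj₁ x≡y)
  ... | no x≢y = ∈-N⁺ ε (inj₂ λ m∈ε →
    let D , D∈T , y∈D , x∉D , m∈D = proj₁ (explains x y x≢y m) m∈ε in unsep D D∈T y∈D x∉D m∈D)

  overlapping⇒nested : ∀ {A B y} → A ∈𝒞 T → B ∈𝒞 T → y ∈ A → y ∈ B → A ⊆ B ⊎ B ⊆ A
  overlapping⇒nested {A} {B} A∈T B∈T y∈A y∈B with compatible A B A∈T B∈T
  ... | inj₁ A⊆B = inj₁ A⊆B
  ... | inj₂ (inj₁ B⊆A) = inj₂ B⊆A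
  ... | inj₂ (inj₂ disjoint) = ⊥-elim (disjoint _ y∈A y∈B)

  PathFree-⁅⁆ : ∀ m y → PathFree m ⁅ y ⁆ y
  PathFree-⁅⁆ m y D _ (_ , x , x∈⁅y⁆ , x∉D) y∈D =
    ⊥-elim (x∉D (subst (_∈ D) (sym (x∈⁅y⁆⇒x≡y y x∈⁅y⁆)) y∈D))

  PathFree-N : ∀ m y → PathFree m (N ε m y) y
  PathFree-N m y D D∈T (_ , x , x∈N , x∉D) y∈D = ∈-N⇒unseparated x∈N D D∈T y∈D x∉D

  cluster≡N : ∀ {C m y} → C ∈𝒞 T → m ∈ label T C → y ∈ C → PathFree m C y → C ≡ N ε m y
  cluster≡N {C} {m} {y} C∈T m∈C y∈C free = ⊆-antisym C⊆N N⊆C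
    where
    C⊆N : C ⊆ N ε m y
    C⊆N {x} x∈C = unseparated⇒∈-N unseparated
      where
      unseparated : Unseparated m y x
      unseparated D D∈T y∈D x∉D with overlapping⇒nested D∈T C∈T y∈D y∈C
      ... | inj₁ D⊆C = free D D∈T (D⊆C , x , x∈C , x∉D) y∈D
      ... | inj₂ C⊆D = ⊥-elim (x∉D (C⊆D x∈C))
    N⊆C : N ε m y ⊆ C
    N⊆C {x} x∈N with x ∈? C
    ... | yes x∈C = x∈C
    ... | no x∉C = ⊥-elim (∈-N⇒unseparated x∈N C C∈T y∈C x∉C m∈C)

  N≡⊤⊎cluster : ∀ m y → N ε m y ≡ ⊤ ⊎ ∃ λ D → D ∈𝒞 T × m ∈ label T D × D ≡ N ε m y
  N≡⊤⊎cluster m y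
    with least-satisfying (⊆-preorder n) (λ D → y ∈? D ×-dec m ∈? label T D) (clusters T)
           (λ A∈T B∈T (y∈A , _) (y∈B , _) → overlapping⇒nested A∈T B∈T y∈A y∈B)
  ... | inj₁ none =
    inj₁ (⊆-antisym ⊆⊤ λ _ → unseparated⇒∈-N λ D D∈T y∈D _ m∈D → none D∈T (y∈D , m∈D))
  ... | inj₂ (D , D∈T , (y∈D , m∈D) , least) = inj₂ (D , D∈T , m∈D , cluster≡N D∈T m∈D y∈D free)
    where
    free : PathFree m D y
    free D′ D′∈T (_ , x , x∈D , x∉D′) y∈D′ m∈D′ = x∉D′ (least D′∈T (y∈D′ , m∈D′) x∈D)

  εTree-coarse-grains : CoarseGraining (εTree ε) T
  εTree-coarse-grains = clusters⊆ , labels⊆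
    where
    clusters⊆ : ∀ C → C ∈𝒞 εTree ε → C ∈𝒞 T
    clusters⊆ C C∈ε with ∈𝒞-εTree⁻ ε C∈ε
    ... | inj₁ refl = hasRoot
    ... | inj₂ (inj₁ (x , refl)) = hasLeaves x
    ... | inj₂ (inj₂ (m , y , refl)) with N≡⊤⊎cluster m y
    ...   | inj₁ N≡⊤ = subst (_∈𝒞 T) (sym N≡⊤) hasRoot
    ...   | inj₂ (D , D∈T , _ , D≡N) = subst (_∈𝒞 T) D≡N D∈T
    labels⊆ : ∀ C → C ∈𝒞 εTree ε → C ≢ ⊤ → label (εTree ε) C ⊆ label T C
    labels⊆ C _ C≢⊤ {m} m∈ with ∈-label-εTree⁻ ε m∈
    ... | y , refl with N≡⊤⊎cluster m y
    ...   | inj₁ N≡⊤ = ⊥-elim (C≢⊤ N≡⊤)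
    ...   | inj₂ (D , _ , m∈D , refl) = m∈D

  leaf⊎inner : ∀ {C} → C ∈𝒞 T → C ≢ ⊤ → (∃ λ x → C ≡ ⁅ x ⁆) ⊎ InnerEdge T C
  leaf⊎inner {C} C∈T C≢⊤ with Fin.any? (λ x → ≡-dec Bool._≟_ C ⁅ x ⁆)
  ... | yes leaf = inj₁ leaf
  ... | no not-leaf = inj₂ (C∈T , C≢⊤ , λ x C≡⁅x⁆ → not-leaf (x , C≡⁅x⁆))

  EdgeConditions : Set
  EdgeConditions = ∀ C → InnerEdge T C → EdgeCondition T C

  coarse-grains⇒edgeConditions : CoarseGraining T (εTree ε) → EdgeConditions
  coarse-grains⇒edgeConditions (clusters⊆ , labels⊆) C (C∈T , C≢⊤ , C≢⁅x⁆) =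
    nonempty-label , path-free-leaf
    where
    nonempty-label : Nonempty (label T C)
    nonempty-label with ∈𝒞-εTree⁻ ε (clusters⊆ C C∈T)
    ... | inj₁ C≡⊤ = ⊥-elim (C≢⊤ C≡⊤)
    ... | inj₂ (inj₁ (x , C≡⁅x⁆)) = ⊥-elim (C≢⁅x⁆ x C≡⁅x⁆)
    ... | inj₂ (inj₂ (m , y , C≡N)) =
      m , proj₂ εTree-coarse-grains C (clusters⊆ C C∈T) C≢⊤ (∈-label-εTree⁺ ε y C≡N)
    path-free-leaf : ∀ m → m ∈ label T C → ∃ λ y → y ∈ C × PathFree m C y
    path-free-leaf m m∈C with ∈-label-εTree⁻ ε (labels⊆ C C∈T C≢⊤ m∈C)
    ... | y , refl = y , ∈-N⁺ ε (inj₁ refl) , PathFree-N m y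

  edgeConditions⇒coarse-grains : EdgeConditions → CoarseGraining T (εTree ε)
  edgeConditions⇒coarse-grains conditions = clusters⊆ , labels⊆
    where
    labelled-by-N : ∀ {C m} → C ∈𝒞 T → C ≢ ⊤ → m ∈ label T C → ∃ λ y → C ≡ N ε m y
    labelled-by-N {C} {m} C∈T C≢⊤ m∈C with leaf⊎inner C∈T C≢⊤
    ... | inj₁ (y , refl) = y , cluster≡N C∈T m∈C (x∈⁅x⁆ y) (PathFree-⁅⁆ m y)
    ... | inj₂ inner with y , y∈C , free ← proj₂ (conditions C inner) m m∈C =
      y , cluster≡N C∈T m∈C y∈C free
    clusters⊆ : ∀ C → C ∈𝒞 T → C ∈𝒞 εTree ε
    clusters⊆ C C∈T with ≡-dec Bool._≟_ C ⊤
    ... | yes refl = ⊤∈εTree ε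
    ... | no C≢⊤ with leaf⊎inner C∈T C≢⊤
    ...   | inj₁ (x , refl) = ⁅x⁆∈εTree ε x
    ...   | inj₂ inner
      with m , m∈C ← proj₁ (conditions C inner)
      with y , refl ← labelled-by-N C∈T C≢⊤ m∈C
      = N∈εTree ε m y
    labels⊆ : ∀ C → C ∈𝒞 T → C ≢ ⊤ → label T C ⊆ label (εTree ε) C
    labels⊆ C C∈T C≢⊤ m∈C = let y , C≡N = labelled-by-N C∈T C≢⊤ m∈C in ∈-label-εTree⁺ ε y C≡N

proposition4 : ∀ {n k : ℕ} (ε : Map n k) (T : ELTree n k) →
    IsPhylogenetic T → Explains T ε →
    (Isomorphic T (εTree ε) → ∀ (C : Subset n) → InnerEdge T C → EdgeCondition T C) ×
    ((∀ (C : Subset n) → InnerEdge T C → EdgeCondition T C) → Isomorphic T (εTree ε))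
proposition4 ε T phylogenetic explains =
  (λ (T≼εTree , _) → coarse-grains⇒edgeConditions T≼εTree) ,
  (λ conditions → edgeConditions⇒coarse-grains conditions , εTree-coarse-grains)
  where open Explained phylogenetic explains
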